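{- Let $\vdash$ be a regular entailment relation for a commutative preordered group $G$, let $A$ be a nonempty finite subset of $G$ and $b_1,\dots,b_m\in G$ ($m\geqslant 1$). If $A+b_1,\dots,A+b_m\vdash b_j$ for every $j=1,\dots,m$, then $A\vdash 0$.
   Context: A commutative preordered group is an abelian group $G$ with a preorder $\leqslant$ such that $a\leqslant b$ implies $a+c\leqslant b+c$. $A,B,A',B'$ denote nonempty finite subsets of $G$; $a$ stands for $\{a\}$, commas denote unions, $A+y=\{a+y:a\in A\}$. A regular entailment relation for $G$ is a relation $A\vdash B$ between nonempty finite subsets such that: (R1) $A\vdash B$ if $A\supseteq A'$, $B\supseteq B'$ and $A'\vdash B'$; (R2) $A\vdash B$ if $A,y\vdash B$ and $A\vdash B,y$; (R3) $a\vdash b$ if $a\leqslant b$; (R4) $A\vdash B$ if $A+y\vdash B+y$; (R5) $a+u,b+v\vdash a+b,u+v$ for all $a,b,u,v\in G$. -}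

module Defs where

open import Level using (Level; _⊔_; suc)
open import Algebra.Bundles using (AbelianGroup)
open import Relation.Binary.Core using (Rel)
open import Relation.Binary.Structures using (IsPreorder)
open import Data.List.NonEmpty using (List⁺; toList; [_]; _⁺++⁺_; map)
import Data.List.Membership.Setoid as Mem

record PreorderedAbelianGroup (c ℓ ℓ₂ : Level) : Set (suc (c ⊔ ℓ ⊔ ℓ₂)) where
  field
    abGroup      : AbelianGroup c ℓ
  open AbelianGroup abGroup public
  field
    _≤_          : Rel Carrier ℓ₂
    isPreorder   : IsPreorder _≈_ _≤_
    +-mono-≤     : ∀ {a b} c → a ≤ b → (a ∙ c) ≤ (b ∙ c)

-- Nonempty finite subsets of G are represented by nonempty lists
-- (List⁺); membership is taken up to the group's equality ≈.
module _ {c ℓ ℓ₂ : Level} (G : PreorderedAbelianGroup c ℓ ℓ₂) where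
  open PreorderedAbelianGroup G

  FinSet : Set c
  FinSet = List⁺ Carrier

  _∈ₛ_ : Carrier → FinSet → Set (c ⊔ ℓ)
  x ∈ₛ A = Mem._∈_ setoid x (toList A)

  _⊇_ : FinSet → FinSet → Set (c ⊔ ℓ)
  A ⊇ A' = ∀ {x} → x ∈ₛ A' → x ∈ₛ A

  _+ₛ_ : FinSet → Carrier → FinSet
  A +ₛ y = map (λ a → a ∙ y) A

  record IsRegularEntailment {e : Level} (_⊢_ : FinSet → FinSet → Set e)
         : Set (c ⊔ ℓ ⊔ ℓ₂ ⊔ e) where
    field
      R1 : ∀ {A B A' B'} → A ⊇ A' → B ⊇ B' → A' ⊢ B' → A ⊢ B
      R2 : ∀ {A B} y → (A ⁺++⁺ [ y ]) ⊢ B → A ⊢ (B ⁺++⁺ [ y ]) → A ⊢ B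
      R3 : ∀ {a b} → a ≤ b → [ a ] ⊢ [ b ]
      R4 : ∀ {A B} y → (A +ₛ y) ⊢ (B +ₛ y) → A ⊢ B
      R5 : ∀ a b u v →
           ([ a ∙ u ] ⁺++⁺ [ b ∙ v ]) ⊢ ([ a ∙ b ] ⁺++⁺ [ u ∙ v ])

-- For m = 1 the hypothesis A + b₁ ⊢ b₁ is A ⊢ 0 translated by b₁ (R4).
-- For m ≥ 2 put d = b₁ − b₂. Since A + b₁ = (A + d) + b₂, the hypothesis for
-- A and b₁, …, b_m implies the one for A, A + d and b₂, …, b_m, so A, A + d ⊢ 0 by
-- induction; symmetrically A, A − d ⊢ 0. Cutting on every element of A + d and of A − d
-- leaves three kinds of branches: all of A + d on the left, all of A − d on the left,
-- or some a + d and some a′ − d on the right. The first two follow from the two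
-- inductive results by weakening, the last from (R5) in the form a, a′ ⊢ a + d, a′ − d.
module Submission where

open import Defs
open import Level using (Level; _⊔_)
open import Function using (id)
open import Data.List.Base using (List; []; _∷_; _++_)
open import Data.List.NonEmpty using (List⁺; toList; [_]; concatMap; _∷_; _⁺++⁺_)
open import Data.List.Relation.Unary.All as All using (All; []; _∷_)
import Data.List.Relation.Unary.All.Properties as Allₚ
open import Data.List.Relation.Unary.Any as Any using (Any; here; there)
import Data.List.Relation.Unary.Any.Properties as Anyₚ
open import Data.List.Relation.Binary.Subset.Propositional using (_⊆_)
import Data.List.Membership.Propositional as Prop
import Data.List.Membership.Setoid as SetoidMembership
open import Data.List.Membership.Setoid.Properties
  using (∈-resp-≈; ∈-++⁺ˡ; ∈-++⁺ʳ; ∈-++⁻; ∈-map⁺; ∈-map⁻; ∈-concat⁺; ∈-concat⁻)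
open import Data.Product using (∃₂; _×_; _,_)
open import Data.Sum using (_⊎_; inj₁; inj₂)
import Relation.Binary.PropositionalEquality as ≡
import Relation.Binary.Reasoning.Setoid as SetoidReasoning

all-or-any : ∀ {a p q} {X : Set a} {P : X → Set p} {Q : X → Set q} {xs : List X} →
             All (λ x → P x ⊎ Q x) xs → All P xs ⊎ Any Q xs
all-or-any [] = inj₁ []
all-or-any (inj₂ q ∷ _) = inj₂ (here q)
all-or-any (inj₁ p ∷ pqs) with all-or-any pqs
... | inj₁ ps = inj₁ (p ∷ ps)
... | inj₂ qs = inj₂ (there qs)

module _ {c ℓ ℓ₂ : Level} (G : PreorderedAbelianGroup c ℓ ℓ₂) where
  open PreorderedAbelianGroup G
  open import Algebra.Properties.AbelianGroup abGroup using (⁻¹-anti-homo‿-)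
  open SetoidMembership setoid using (_∈_; find)
  open SetoidReasoning setoid

  x∙[y-z]∙z≈x∙y : ∀ x y z → (x ∙ (y - z)) ∙ z ≈ x ∙ y
  x∙[y-z]∙z≈x∙y x y z = begin
    (x ∙ (y - z)) ∙ z     ≈⟨ assoc x (y - z) z ⟩
    x ∙ ((y ∙ z ⁻¹) ∙ z)  ≈⟨ ∙-congˡ (assoc y (z ⁻¹) z) ⟩
    x ∙ (y ∙ (z ⁻¹ ∙ z))  ≈⟨ ∙-congˡ (∙-congˡ (inverseˡ z)) ⟩
    x ∙ (y ∙ ε)           ≈⟨ ∙-congˡ (identityʳ y) ⟩
    x ∙ y                 ∎

  [x-y]∙[y-x]≈ε : ∀ x y → (x - y) ∙ (y - x) ≈ ε
  [x-y]∙[y-x]≈ε x y = begin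
    (x - y) ∙ (y - x)      ≈⟨ ∙-congˡ (⁻¹-anti-homo‿- x y) ⟨
    (x - y) ∙ (x - y) ⁻¹   ≈⟨ inverseʳ (x - y) ⟩
    ε                      ∎

  d∙[x∙e]≈x : ∀ {d e} x → d ∙ e ≈ ε → d ∙ (x ∙ e) ≈ x
  d∙[x∙e]≈x {d} {e} x d∙e≈ε = begin
    d ∙ (x ∙ e)  ≈⟨ ∙-congˡ (comm x e) ⟩
    d ∙ (e ∙ x)  ≈⟨ assoc d e x ⟨
    (d ∙ e) ∙ x  ≈⟨ ∙-congʳ d∙e≈ε ⟩
    ε ∙ x        ≈⟨ identityˡ x ⟩
    x            ∎

  infix 4 _⊇ᴳ_
  infixl 6 _+ᴳ_

  _⊇ᴳ_ : FinSet G → FinSet G → Set (c ⊔ ℓ)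
  _⊇ᴳ_ = _⊇_ G

  _+ᴳ_ : FinSet G → Carrier → FinSet G
  _+ᴳ_ = _+ₛ_ G

  ⊇-refl : ∀ {A} → A ⊇ᴳ A
  ⊇-refl x∈A = x∈A

  ⊇-trans : ∀ {A B C} → A ⊇ᴳ B → B ⊇ᴳ C → A ⊇ᴳ C
  ⊇-trans A⊇B B⊇C x∈C = A⊇B (B⊇C x∈C)

  ⁺++⁺-⊇ˡ : ∀ {A B} → (A ⁺++⁺ B) ⊇ᴳ A
  ⁺++⁺-⊇ˡ = ∈-++⁺ˡ setoid

  ⁺++⁺-⊇ʳ : ∀ {A B} → (A ⁺++⁺ B) ⊇ᴳ B
  ⁺++⁺-⊇ʳ {A} = ∈-++⁺ʳ setoid (toList A)

  ⊇-⁺++⁺ : ∀ {A B C} → C ⊇ᴳ A → C ⊇ᴳ B → C ⊇ᴳ (A ⁺++⁺ B)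
  ⊇-⁺++⁺ {A} C⊇A C⊇B x∈A++B with ∈-++⁻ setoid (toList A) x∈A++B
  ... | inj₁ x∈A = C⊇A x∈A
  ... | inj₂ x∈B = C⊇B x∈B

  All⇒⊇ : ∀ {A B} → All (_∈ toList A) (toList B) → A ⊇ᴳ B
  All⇒⊇ = All.lookupₛ setoid (∈-resp-≈ setoid)

  ∈-+ᴳ⁺ : ∀ {a A} y → a ∈ toList A → a ∙ y ∈ toList (A +ᴳ y)
  ∈-+ᴳ⁺ y = ∈-map⁺ setoid setoid ∙-congʳ

  translates : FinSet G → List⁺ Carrier → FinSet G
  translates A bs = concatMap (A +ᴳ_) bs

  ∈-translates⁺ : ∀ {a b A bs} → a ∈ toList A → b Prop.∈ toList bs →
                  a ∙ b ∈ toList (translates A bs)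
  ∈-translates⁺ {A = A} a∈A b∈bs = ∈-concat⁺ setoid
    (Anyₚ.map⁺ {f = toList} (Anyₚ.map⁺ {f = A +ᴳ_} (Any.map (λ { ≡.refl → ∈-+ᴳ⁺ _ a∈A }) b∈bs)))

  ∈-translates⁻ : ∀ {x} A bs → x ∈ toList (translates A bs) →
                  ∃₂ λ a b → a ∈ toList A × b Prop.∈ toList bs × x ≈ a ∙ b
  ∈-translates⁻ A bs x∈
    with b , b∈bs , x∈A+b ← Prop.find
      (Anyₚ.map⁻ {f = A +ᴳ_} (Anyₚ.map⁻ {f = toList} (∈-concat⁻ setoid _ x∈)))
    with a , a∈A , x≈a∙b ← ∈-map⁻ setoid setoid x∈A+b
    = a , b , a∈A , b∈bs , x≈a∙b

  translates-[_] : ∀ {A} b → (A +ᴳ b) ⊇ᴳ translates A [ b ]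
  translates-[_] {A} b x∈ with ∈-translates⁻ A [ b ] x∈
  ... | a , _ , a∈A , here ≡.refl , x≈a∙b = ∈-resp-≈ setoid (sym x≈a∙b) (∈-+ᴳ⁺ b a∈A)

  translates-⊇ : ∀ {A A′} bs bs′ →
    (∀ {a b} → a ∈ toList A → b Prop.∈ toList bs → a ∙ b ∈ toList (translates A′ bs′)) →
    translates A′ bs′ ⊇ᴳ translates A bs
  translates-⊇ {A} bs bs′ sums∈ x∈ =
    let a , b , a∈A , b∈bs , x≈a∙b = ∈-translates⁻ A bs x∈
    in ∈-resp-≈ setoid (sym x≈a∙b) (sums∈ a∈A b∈bs)

  translates-absorb : ∀ {A c} b cs bs → c Prop.∈ toList cs → toList bs ⊆ b ∷ toList cs →
                      translates (A ⁺++⁺ (A +ᴳ (b - c))) cs ⊇ᴳ translates A bs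
  translates-absorb {A} {c} b cs bs c∈cs bs⊆b∷cs =
    translates-⊇ bs cs λ a∈A b′∈bs → absorbed a∈A (bs⊆b∷cs b′∈bs)
    where
    absorbed : ∀ {a b′} → a ∈ toList A → b′ Prop.∈ b ∷ toList cs →
               a ∙ b′ ∈ toList (translates (A ⁺++⁺ (A +ᴳ (b - c))) cs)
    absorbed {a} a∈A (here ≡.refl) = ∈-resp-≈ setoid (x∙[y-z]∙z≈x∙y a b c)
      (∈-translates⁺ (⁺++⁺-⊇ʳ (∈-+ᴳ⁺ (b - c) a∈A)) c∈cs)
    absorbed a∈A (there b′∈cs) = ∈-translates⁺ (⁺++⁺-⊇ˡ a∈A) b′∈cs

  module _ {e} {_⊢_ : FinSet G → FinSet G → Set e} (R : IsRegularEntailment G _⊢_) where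
    open IsRegularEntailment R

    cut-all : ∀ {Γ Δ} (Z : List Carrier) →
              (∀ {Γ′ Δ′} → Γ′ ⊇ᴳ Γ → Δ′ ⊇ᴳ Δ →
                 All (λ z → z ∈ toList Γ′ ⊎ z ∈ toList Δ′) Z → Γ′ ⊢ Δ′) →
              Γ ⊢ Δ
    cut-all [] close = close ⊇-refl ⊇-refl []
    cut-all (z ∷ Z) close = R2 z
      (cut-all Z λ Γ′⊇ Δ′⊇ placed →
        close (⊇-trans Γ′⊇ ⁺++⁺-⊇ˡ) Δ′⊇ (inj₁ (Γ′⊇ (⁺++⁺-⊇ʳ (here refl))) ∷ placed))
      (cut-all Z λ Γ′⊇ Δ′⊇ placed →
        close Γ′⊇ (⊇-trans Δ′⊇ ⁺++⁺-⊇ˡ) (inj₂ (Δ′⊇ (⁺++⁺-⊇ʳ (here refl))) ∷ placed))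

    R5-opposite : ∀ a a′ {d e} → d ∙ e ≈ ε → ([ a ] ⁺++⁺ [ a′ ]) ⊢ ([ a ∙ d ] ⁺++⁺ [ a′ ∙ e ])
    R5-opposite a a′ {d} {e} d∙e≈ε =
      R1 (All⇒⊇ (here (identityʳ a) ∷ there (here (d∙[x∙e]≈x a′ d∙e≈ε)) ∷ []))
         (All⇒⊇ (here refl ∷ there (here (identityˡ (a′ ∙ e))) ∷ []))
         (R5 a d ε (a′ ∙ e))

    ⊢ε-from-opposite-translates : ∀ {A d e} → d ∙ e ≈ ε →
      (A ⁺++⁺ (A +ᴳ d)) ⊢ [ ε ] → (A ⁺++⁺ (A +ᴳ e)) ⊢ [ ε ] → A ⊢ [ ε ]
    ⊢ε-from-opposite-translates {A} {d} {e} d∙e≈ε A,A+d⊢ε A,A+e⊢ε =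
      cut-all (toList (A +ᴳ d) ++ toList (A +ᴳ e)) close
      where
      close : ∀ {Γ Δ} → Γ ⊇ᴳ A → Δ ⊇ᴳ [ ε ] →
              All (λ z → z ∈ toList Γ ⊎ z ∈ toList Δ) (toList (A +ᴳ d) ++ toList (A +ᴳ e)) →
              Γ ⊢ Δ
      close Γ⊇A Δ⊇ε placed with placedᵈ , placedᵉ ← Allₚ.++⁻ (toList (A +ᴳ d)) placed
        with all-or-any placedᵈ | all-or-any placedᵉ
      ... | inj₁ Γ∋A+d | _ = R1 (⊇-⁺++⁺ Γ⊇A (All⇒⊇ Γ∋A+d)) Δ⊇ε A,A+d⊢ε
      ... | inj₂ _ | inj₁ Γ∋A+e = R1 (⊇-⁺++⁺ Γ⊇A (All⇒⊇ Γ∋A+e)) Δ⊇ε A,A+e⊢ε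
      ... | inj₂ Δ∋A+d | inj₂ Δ∋A+e
        with a , a∈A , a∙d∈Δ ← find (Anyₚ.map⁻ Δ∋A+d)
        with a′ , a′∈A , a′∙e∈Δ ← find (Anyₚ.map⁻ Δ∋A+e)
        = R1 (All⇒⊇ (Γ⊇A a∈A ∷ Γ⊇A a′∈A ∷ []))
             (All⇒⊇ (a∙d∈Δ ∷ a′∙e∈Δ ∷ []))
             (R5-opposite a a′ d∙e≈ε)

    ⊢ε-from-translates : ∀ {A} b bs →
      All (λ bⱼ → translates A (b ∷ bs) ⊢ [ bⱼ ]) (b ∷ bs) → A ⊢ [ ε ]
    ⊢ε-from-translates {A} b [] (A+b⊢b ∷ []) =
      R4 b (R1 translates-[ b ] (All⇒⊇ (here (sym (identityˡ b)) ∷ [])) A+b⊢b)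
    ⊢ε-from-translates {A} b (b′ ∷ bs) (⊢b ∷ ⊢b′ ∷ ⊢bs) =
      ⊢ε-from-opposite-translates ([x-y]∙[y-x]≈ε b b′)
        (⊢ε-from-translates b′ bs
          (All.map (R1 (translates-absorb b (b′ ∷ bs) (b ∷ b′ ∷ bs) (here ≡.refl) id) ⊇-refl)
                   (⊢b′ ∷ ⊢bs)))
        (⊢ε-from-translates b bs
          (All.map (R1 (translates-absorb b′ (b ∷ bs) (b ∷ b′ ∷ bs) (here ≡.refl) swap) ⊇-refl)
                   (⊢b ∷ ⊢bs)))
      where
      swap : b ∷ b′ ∷ bs ⊆ b′ ∷ b ∷ bs
      swap (here ≡.refl) = there (here ≡.refl)
      swap (there (here ≡.refl)) = here ≡.refl
      swap (there (there b″∈bs)) = there (there b″∈bs)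

proposition1p9 : {c ℓ ℓ₂ e : Level} (G : PreorderedAbelianGroup c ℓ ℓ₂)
    → let open PreorderedAbelianGroup G in
      (_⊢_ : FinSet G → FinSet G → Set e) → IsRegularEntailment G _⊢_
    → (A : FinSet G) (bs : List⁺ Carrier)
    → All (λ bj → (concatMap (λ bi → _+ₛ_ G A bi) bs) ⊢ [ bj ]) (toList bs)
    → A ⊢ [ ε ]
proposition1p9 G _⊢_ R A (b ∷ bs) = ⊢ε-from-translates G R b bs
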